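{- The classes of partial $\mathsf{NCC}$-realisers and of weak partial $\mathsf{NCC}$-realisers are computationally equivalent: every partial $\mathsf{NCC}$-realiser computes a weak partial $\mathsf{NCC}$-realiser, and every weak partial $\mathsf{NCC}$-realiser computes a partial $\mathsf{NCC}$-realiser.
   Context: $2^{\mathbb N}$ is Cantor space; computability is in Kleene's S1–S9 sense (relative to partial functionals whose arguments are total objects). (a) A partial $\mathsf{NCC}$-realiser is a partial functional $\zeta_{\mathsf p}$ taking as arguments total $Y:\mathbb N^2\times 2^{\mathbb N}\to\mathbb N$ such that if $(\forall n)(\exists m)(\exists f\in 2^{\mathbb N})(Y(n,m,f)=0)$ then $\zeta_{\mathsf p}(Y)=g$ is defined and $(\forall n)(\exists f\in 2^{\mathbb N})(Y(n,g(n),f)=0)$. (b) A weak partial $\mathsf{NCC}$-realiser is a partial functional $\zeta_{\mathsf p_0}$ taking as arguments total $Y:\mathbb N\times 2^{\mathbb N}\to\mathbb N$ such that if $(\exists m)(\exists f\in 2^{\mathbb N})(Y(m,f)=0)$ then $\zeta_{\mathsf p_0}(Y)$ terminates and yields an $m$ with $(\exists f\in 2^{\mathbb N})(Y(m,f)=0)$. -}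

module Defs where

open import Data.Nat using (ℕ; zero; suc)
open import Data.Bool using (Bool; true; false; if_then_else_)
open import Data.List using (List; []; _∷_; _++_)
open import Data.Product using (Σ; _×_; _,_; ∃)
open import Data.Unit using (⊤; tt)
open import Relation.Binary.PropositionalEquality using (_≡_)

-- Finite types (Kleene style): a type is (σ₁,…,σₖ → ℕ); ι = ( → ℕ).

data Ty : Set where
  ar : List Ty → Ty

ι : Ty
ι = ar []

mutual
  ⟦_⟧ : Ty → Set
  ⟦ ar σs ⟧ = Args σs → ℕ

  Args : List Ty → Set
  Args [] = ⊤
  Args (σ ∷ σs) = ⟦ σ ⟧ × Args σs

num : ℕ → ⟦ ι ⟧
num n = λ _ → n

-- extensional equality of total objects (logical relation); an object x
-- is a (hereditarily extensional) total functional iff  Eq σ x x.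
mutual
  Eq : (σ : Ty) → ⟦ σ ⟧ → ⟦ σ ⟧ → Set
  Eq (ar σs) f g = ∀ a b → EqA σs a b → f a ≡ g b

  EqA : (σs : List Ty) → Args σs → Args σs → Set
  EqA [] _ _ = ⊤
  EqA (σ ∷ σs) (x , a) (y , b) = Eq σ x y × EqA σs a b

-- A partial functional with (total) arguments of types σs, given by its graph;
-- it is single-valued and extensional.
IsPartialFunctional : (σs : List Ty) → (Args σs → ℕ → Set) → Set
IsPartialFunctional σs R = ∀ a b m n → EqA σs a b → R a m → R b n → m ≡ n

appendA : ∀ {τs σs} → Args τs → Args σs → Args (τs ++ σs)
appendA {[]} _ b = b
appendA {τ ∷ τs} (x , a) b = x , appendA a b

swapTy : ℕ → List Ty → List Ty
swapTy zero [] = []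
swapTy zero (a ∷ []) = a ∷ []
swapTy zero (a ∷ b ∷ s) = b ∷ a ∷ s
swapTy (suc i) [] = []
swapTy (suc i) (a ∷ s) = a ∷ swapTy i s

swapA : ∀ i {σs} → Args σs → Args (swapTy i σs)
swapA zero {[]} a = a
swapA zero {_ ∷ []} a = a
swapA zero {_ ∷ _ ∷ _} (x , y , a) = y , x , a
swapA (suc i) {[]} a = a
swapA (suc i) {_ ∷ _} (x , a) = x , swapA i a

-- Kleene indices: natural numbers, decoded into schemes S1–S9.

data Scheme : Set where
  s1 : Scheme
  s2 : ℕ → Scheme
  s3 : Scheme
  s4 : ℕ → ℕ → Scheme
  s5 : ℕ → ℕ → Scheme
  s6 : ℕ → ℕ → Scheme         -- permutation (swap positions i, i+1)
  s8 : ℕ → Scheme             -- application of first argument (S7/S8)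
  sO : ℕ → Scheme             -- application of the oracle (S8 for the partial functional)
  s9 : Scheme

-- bijection ℕ → ℕ × ℕ (enumeration along diagonals)
unpair : ℕ → ℕ × ℕ
unpair zero = 0 , 0
unpair (suc n) with unpair n
... | a , zero = 0 , suc a
... | a , suc b = suc a , b

decodeWith : ℕ → ℕ → Scheme
decodeWith 0 r = s1
decodeWith 1 r = s2 r
decodeWith 2 r = s3
decodeWith 3 r with unpair r
... | a , b = s4 a b
decodeWith 4 r with unpair r
... | a , b = s5 a b
decodeWith 5 r with unpair r
... | a , b = s6 a b
decodeWith 6 r = s8 r
decodeWith 7 r = sO r
decodeWith 8 r = s9
decodeWith (suc (suc (suc (suc (suc (suc (suc (suc (suc _))))))))) r = s1

decode : ℕ → Scheme
decode n with unpair n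
... | t , r = decodeWith t r

-- Kleene S1–S9 computation relative to a partial functional Ω
-- (whose arguments are total objects of types ωs).
-- Comp e Φ n  means  {e}^Ω(Φ) ↓ n.

module Kleene (ωs : List Ty) (Ω : Args ωs → ℕ → Set) where

  mutual
    data Comp : {σs : List Ty} → ℕ → Args σs → ℕ → Set where
      S1 : ∀ {e σs} {x : ⟦ ι ⟧} {Φ : Args σs} → decode e ≡ s1 →
           Comp {ι ∷ σs} e (x , Φ) (suc (x tt))
      S2 : ∀ {e q σs} {Φ : Args σs} → decode e ≡ s2 q → Comp e Φ q
      S3 : ∀ {e σs} {x : ⟦ ι ⟧} {Φ : Args σs} → decode e ≡ s3 →
           Comp {ι ∷ σs} e (x , Φ) (x tt)
      S4 : ∀ {e e₁ e₂ m n σs} {Φ : Args σs} → decode e ≡ s4 e₁ e₂ →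
           Comp e₂ Φ m → Comp {ι ∷ σs} e₁ (num m , Φ) n → Comp e Φ n
      S5z : ∀ {e e₁ e₂ n σs} {x : ⟦ ι ⟧} {Φ : Args σs} → decode e ≡ s5 e₁ e₂ →
            x tt ≡ 0 → Comp e₁ Φ n → Comp {ι ∷ σs} e (x , Φ) n
      S5s : ∀ {e e₁ e₂ k m n σs} {x : ⟦ ι ⟧} {Φ : Args σs} → decode e ≡ s5 e₁ e₂ →
            x tt ≡ suc k → Comp {ι ∷ σs} e (num k , Φ) m →
            Comp {ι ∷ ι ∷ σs} e₂ (num m , num k , Φ) n → Comp {ι ∷ σs} e (x , Φ) n
      S6 : ∀ {e i e₁ n σs} {Φ : Args σs} → decode e ≡ s6 i e₁ →
           Comp e₁ (swapA i Φ) n → Comp e Φ n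
      S8 : ∀ {e e₁ ρs σs} {F : ⟦ ar ρs ⟧} {Φ : Args σs} {ψ : Args ρs} →
           decode e ≡ s8 e₁ → Tots e₁ {ar ρs ∷ σs} (F , Φ) 0 ρs ψ →
           Comp {ar ρs ∷ σs} e (F , Φ) (F ψ)
      SO : ∀ {e e₁ n σs} {Φ : Args σs} {ψ : Args ωs} →
           decode e ≡ sO e₁ → Tots e₁ Φ 0 ωs ψ → Ω ψ n → Comp e Φ n
      S9 : ∀ {e n σs} {x : ⟦ ι ⟧} {Φ : Args σs} → decode e ≡ s9 →
           Comp (x tt) Φ n → Comp {ι ∷ σs} e (x , Φ) n

    -- Tots e Φ i ρs ψ : the j-th component of ψ (j ≥ i) is the total
    -- functional  λξ. {e}(j, ξ, Φ).
    data Tots (e : ℕ) {σs : List Ty} (Φ : Args σs) : ℕ → (ρs : List Ty) → Args ρs → Set where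
      [] : ∀ {i} → Tots e Φ i [] tt
      _∷_ : ∀ {i τs ρs} {ψ₀ : ⟦ ar τs ⟧} {ψ : Args ρs} →
            (∀ (ξ : Args τs) → Comp {ι ∷ (τs ++ σs)} e (num i , appendA ξ Φ) (ψ₀ ξ)) →
            Tots e Φ (suc i) ρs ψ → Tots e Φ i (ar τs ∷ ρs) (ψ₀ , ψ)

ComputableIn : ∀ {ωs σs} → (Args ωs → ℕ → Set) → (Args σs → ℕ → Set) → Set
ComputableIn {ωs} {σs} Ω R =
  Σ ℕ λ e → ∀ (a : Args σs) m → (R a m → Kleene.Comp ωs Ω e a m) × (Kleene.Comp ωs Ω e a m → R a m)

T1 : Ty
T1 = ar (ι ∷ [])

cantor : (ℕ → Bool) → ⟦ T1 ⟧
cantor f (x , _) = if f (x tt) then 1 else 0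

TY : Ty
TY = ar (ι ∷ ι ∷ T1 ∷ [])

TY₀ : Ty
TY₀ = ar (ι ∷ T1 ∷ [])

app₂ : ⟦ TY ⟧ → ℕ → ℕ → (ℕ → Bool) → ℕ
app₂ Y n m f = Y (num n , num m , cantor f , tt)

app₁ : ⟦ TY₀ ⟧ → ℕ → (ℕ → Bool) → ℕ
app₁ Y m f = Y (num m , cantor f , tt)

-- A partial NCC-realiser ζ_p, given as the partial functional (Y , n) ↦ ζ_p(Y)(n).
IsPartialNCC : (Args (TY ∷ ι ∷ []) → ℕ → Set) → Set
IsPartialNCC ζ =
  IsPartialFunctional (TY ∷ ι ∷ []) ζ ×
  (∀ (Y : ⟦ TY ⟧) → Eq TY Y Y →
     (∀ n → Σ ℕ λ m → Σ (ℕ → Bool) λ f → app₂ Y n m f ≡ 0) →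
     Σ (ℕ → ℕ) λ g → (∀ n → ζ (Y , num n , tt) (g n)) ×
                     (∀ n → Σ (ℕ → Bool) λ f → app₂ Y n (g n) f ≡ 0))

IsWeakPartialNCC : (Args (TY₀ ∷ []) → ℕ → Set) → Set
IsWeakPartialNCC ζ =
  IsPartialFunctional (TY₀ ∷ []) ζ ×
  (∀ (Y : ⟦ TY₀ ⟧) → Eq TY₀ Y Y →
     (Σ ℕ λ m → Σ (ℕ → Bool) λ f → app₁ Y m f ≡ 0) →
     Σ ℕ λ m → ζ (Y , tt) m × (Σ (ℕ → Bool) λ f → app₁ Y m f ≡ 0))

-- Each kind of realiser is obtained from the other by a single oracle call.  Given ζ_p, a weak
-- realiser is ζ_p0(Y) := ζ_p(λn m f. Y(m,f))(0); given ζ_p0, a realiser is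
-- ζ_p(Y)(n) := ζ_p0(λm f. Y(n,m,f)).  Both are Kleene-computable in the given realiser, and the
-- graph of a Kleene computation relative to a single-valued oracle is single-valued, so they
-- are again partial functionals.
module Submission where

open import Defs
open import Data.Nat using (ℕ; zero; suc; _+_)
open import Data.Nat.Properties using (+-suc; +-identityʳ; 0≢1+n; suc-injective)
open import Data.Bool using (Bool)
open import Data.List using (List; []; _∷_; _++_)
open import Data.Product using (Σ; _×_; _,_; proj₁; proj₂)
open import Data.Unit using (tt)
open import Data.Empty using (⊥-elim)
open import Function using (id)
open import Relation.Binary.PropositionalEquality using (_≡_; refl; sym; trans; cong; subst)

triangle : ℕ → ℕ
triangle zero = zero
triangle (suc s) = suc (s + triangle s)

unpair-diagonal : ∀ s a y → a + y ≡ s → unpair (a + triangle s) ≡ (a , y)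
unpair-diagonal zero zero zero refl = refl
unpair-diagonal (suc s) zero y refl
  with unpair (s + triangle s) | unpair-diagonal s s 0 (+-identityʳ s)
... | .(s , 0) | refl = refl
unpair-diagonal s (suc a) y a+y≡s
  with unpair (a + triangle s) | unpair-diagonal s a (suc y) (trans (+-suc a y) a+y≡s)
... | .(a , suc y) | refl = refl

-- Opaque so that typechecking never normalises the (unary, very large) codes of concrete programs.
opaque
  pair : ℕ → ℕ → ℕ
  pair a y = a + triangle (a + y)

  unpair-pair : ∀ a y → unpair (pair a y) ≡ (a , y)
  unpair-pair a y = unpair-diagonal (a + y) a y refl

  code : Scheme → ℕ
  code s1 = pair 0 0
  code (s2 q) = pair 1 q
  code s3 = pair 2 0
  code (s4 a b) = pair 3 (pair a b)
  code (s5 a b) = pair 4 (pair a b)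
  code (s6 a b) = pair 5 (pair a b)
  code (s8 r) = pair 6 r
  code (sO r) = pair 7 r
  code s9 = pair 8 0

  decode-pair : ∀ t r → decode (pair t r) ≡ decodeWith t r
  decode-pair t r with unpair (pair t r) | unpair-pair t r
  ... | .(t , r) | refl = refl

  decode-code : ∀ s → decode (code s) ≡ s
  decode-code s1 = decode-pair 0 0
  decode-code (s2 q) = decode-pair 1 q
  decode-code s3 = decode-pair 2 0
  decode-code (s4 a b) rewrite decode-pair 3 (pair a b) | unpair-pair a b = refl
  decode-code (s5 a b) rewrite decode-pair 4 (pair a b) | unpair-pair a b = refl
  decode-code (s6 a b) rewrite decode-pair 5 (pair a b) | unpair-pair a b = refl
  decode-code (s8 r) = decode-pair 6 r
  decode-code (sO r) = decode-pair 7 r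
  decode-code s9 = decode-pair 8 0

appendA-cong : ∀ {τs σs} {ξ ξ' : Args τs} {Φ Φ' : Args σs} → EqA τs ξ ξ' → EqA σs Φ Φ' →
               EqA (τs ++ σs) (appendA ξ Φ) (appendA ξ' Φ')
appendA-cong {[]} _ Φ≈Φ' = Φ≈Φ'
appendA-cong {τ ∷ τs} (x≈x' , ξ≈ξ') Φ≈Φ' = x≈x' , appendA-cong ξ≈ξ' Φ≈Φ'

swapA-cong : ∀ i {σs} {Φ Φ' : Args σs} → EqA σs Φ Φ' → EqA (swapTy i σs) (swapA i Φ) (swapA i Φ')
swapA-cong zero {[]} Φ≈Φ' = Φ≈Φ'
swapA-cong zero {_ ∷ []} Φ≈Φ' = Φ≈Φ'
swapA-cong zero {_ ∷ _ ∷ _} (x≈x' , y≈y' , Φ≈Φ') = y≈y' , x≈x' , Φ≈Φ'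
swapA-cong (suc i) {[]} Φ≈Φ' = Φ≈Φ'
swapA-cong (suc i) {_ ∷ _} (x≈x' , Φ≈Φ') = x≈x' , swapA-cong i Φ≈Φ'

num-cong : ∀ {m n} → m ≡ n → Eq ι (num m) (num n)
num-cong m≡n _ _ _ = m≡n

-- Moves argument k to the front, keeping the order of the others (the effect of pull k below).
toFrontTy : ℕ → List Ty → List Ty
toFrontTy zero σs = σs
toFrontTy (suc k) σs = toFrontTy k (swapTy k σs)

toFront : ∀ k {σs} → Args σs → Args (toFrontTy k σs)
toFront zero Φ = Φ
toFront (suc k) Φ = toFront k (swapA k Φ)

module _ {ωs : List Ty} {Ω : Args ωs → ℕ → Set} where

  open Kleene ωs Ω

  -- Indexing the last rule of a computation by the scheme lets comp-functional match two
  -- computations of the same index without a case for every pair of rules.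
  data Step (e : ℕ) : Scheme → {σs : List Ty} → Args σs → ℕ → Set where
    step-s1 : ∀ {σs x} {Φ : Args σs} → Step e s1 {ι ∷ σs} (x , Φ) (suc (x tt))
    step-s2 : ∀ {q σs} {Φ : Args σs} → Step e (s2 q) Φ q
    step-s3 : ∀ {σs x} {Φ : Args σs} → Step e s3 {ι ∷ σs} (x , Φ) (x tt)
    step-s4 : ∀ {e₁ e₂ m n σs} {Φ : Args σs} →
              Comp e₂ Φ m → Comp {ι ∷ σs} e₁ (num m , Φ) n → Step e (s4 e₁ e₂) Φ n
    step-s5z : ∀ {e₁ e₂ n σs x} {Φ : Args σs} →
               x tt ≡ 0 → Comp e₁ Φ n → Step e (s5 e₁ e₂) {ι ∷ σs} (x , Φ) n
    step-s5s : ∀ {e₁ e₂ k m n σs x} {Φ : Args σs} →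
               x tt ≡ suc k → Comp {ι ∷ σs} e (num k , Φ) m →
               Comp {ι ∷ ι ∷ σs} e₂ (num m , num k , Φ) n → Step e (s5 e₁ e₂) {ι ∷ σs} (x , Φ) n
    step-s6 : ∀ {i e₁ n σs} {Φ : Args σs} → Comp e₁ (swapA i Φ) n → Step e (s6 i e₁) Φ n
    step-s8 : ∀ {e₁ ρs σs} {F : ⟦ ar ρs ⟧} {Φ : Args σs} {ψ : Args ρs} →
              Tots e₁ {ar ρs ∷ σs} (F , Φ) 0 ρs ψ → Step e (s8 e₁) {ar ρs ∷ σs} (F , Φ) (F ψ)
    step-sO : ∀ {e₁ n σs} {Φ : Args σs} {ψ : Args ωs} →
              Tots e₁ Φ 0 ωs ψ → Ω ψ n → Step e (sO e₁) Φ n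
    step-s9 : ∀ {n σs x} {Φ : Args σs} → Comp (x tt) Φ n → Step e s9 {ι ∷ σs} (x , Φ) n

  retag : ∀ {e s t σs} {Φ : Args σs} {n} → s ≡ t → Step e s Φ n → Step e t Φ n
  retag refl st = st

  lastStep : ∀ {e s σs} {Φ : Args σs} {n} → decode e ≡ s → Comp e Φ n → Step e s Φ n
  lastStep p (S1 q) = retag (trans (sym q) p) step-s1
  lastStep p (S2 q) = retag (trans (sym q) p) step-s2
  lastStep p (S3 q) = retag (trans (sym q) p) step-s3
  lastStep p (S4 q d₁ d₂) = retag (trans (sym q) p) (step-s4 d₁ d₂)
  lastStep p (S5z q z d) = retag (trans (sym q) p) (step-s5z z d)
  lastStep p (S5s q z d₁ d₂) = retag (trans (sym q) p) (step-s5s z d₁ d₂)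
  lastStep p (S6 q d) = retag (trans (sym q) p) (step-s6 d)
  lastStep p (S8 q t) = retag (trans (sym q) p) (step-s8 t)
  lastStep p (SO q t o) = retag (trans (sym q) p) (step-sO t o)
  lastStep p (S9 q d) = retag (trans (sym q) p) (step-s9 d)

  module _ (Ω-functional : IsPartialFunctional ωs Ω) where

    mutual
      comp-functional : ∀ {σs e} {Φ Φ' : Args σs} {v w} →
                        EqA σs Φ Φ' → Comp e Φ v → Comp e Φ' w → v ≡ w
      comp-functional (x≈x' , _) (S1 p) d' with lastStep p d'
      ... | step-s1 = cong suc (x≈x' tt tt tt)
      comp-functional _ (S2 p) d' with lastStep p d'
      ... | step-s2 = refl
      comp-functional (x≈x' , _) (S3 p) d' with lastStep p d'
      ... | step-s3 = x≈x' tt tt tt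
      comp-functional Φ≈Φ' (S4 p d₁ d₂) d' with lastStep p d'
      ... | step-s4 d₁' d₂' =
        comp-functional (num-cong (comp-functional Φ≈Φ' d₁ d₁') , Φ≈Φ') d₂ d₂'
      comp-functional (x≈x' , Φ≈Φ') (S5z p z d) d' with lastStep p d'
      ... | step-s5z _ d'' = comp-functional Φ≈Φ' d d''
      ... | step-s5s z' _ _ = ⊥-elim (0≢1+n (trans (sym z) (trans (x≈x' tt tt tt) z')))
      comp-functional (x≈x' , Φ≈Φ') (S5s p z d₁ d₂) d' with lastStep p d'
      ... | step-s5z z' _ = ⊥-elim (0≢1+n (trans (sym z') (trans (sym (x≈x' tt tt tt)) z)))
      ... | step-s5s z' d₁' d₂' =
        comp-functional (num-cong (comp-functional (k≈k' , Φ≈Φ') d₁ d₁') , k≈k' , Φ≈Φ') d₂ d₂'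
        where
          k≈k' : Eq ι _ _
          k≈k' = num-cong (suc-injective (trans (sym z) (trans (x≈x' tt tt tt) z')))
      comp-functional Φ≈Φ' (S6 {i = i} p d) d' with lastStep p d'
      ... | step-s6 d'' = comp-functional (swapA-cong i Φ≈Φ') d d''
      comp-functional (F≈F' , Φ≈Φ') (S8 p t) d' with lastStep p d'
      ... | step-s8 t' = F≈F' _ _ (tots-functional (F≈F' , Φ≈Φ') t t')
      comp-functional Φ≈Φ' (SO p t o) d' with lastStep p d'
      ... | step-sO t' o' = Ω-functional _ _ _ _ (tots-functional Φ≈Φ' t t') o o'
      comp-functional {Φ' = x' , Φ'} (x≈x' , Φ≈Φ') (S9 p d) d' with lastStep p d'
      ... | step-s9 d'' =
        comp-functional Φ≈Φ' d (subst (λ e → Comp e Φ' _) (sym (x≈x' tt tt tt)) d'')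

      tots-functional : ∀ {σs e} {Φ Φ' : Args σs} {i ρs ψ ψ'} → EqA σs Φ Φ' →
                        Tots e Φ i ρs ψ → Tots e Φ' i ρs ψ' → EqA ρs ψ ψ'
      tots-functional Φ≈Φ' [] [] = tt
      tots-functional Φ≈Φ' (c ∷ t) (c' ∷ t') =
        (λ ξ ξ' ξ≈ξ' → comp-functional (num-cong refl , appendA-cong ξ≈ξ' Φ≈Φ') (c ξ) (c' ξ'))
        , tots-functional Φ≈Φ' t t'

    comp-isPartialFunctional : ∀ {σs} e → IsPartialFunctional σs (Comp e)
    comp-isPartialFunctional e _ _ _ _ = comp-functional

  comp-computableIn : ∀ {σs} e → ComputableIn Ω (Comp {σs} e)
  comp-computableIn e = e , λ _ _ → id , id

const : ℕ → ℕ
const q = code (s2 q)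

head : ℕ
head = code s3

pull : ℕ → ℕ → ℕ
pull zero e = e
pull (suc k) e = code (s6 k (pull k e))

apply : ℕ → ℕ
apply e = code (s8 e)

oracle : ℕ → ℕ
oracle e = code (sO e)

-- Primitive recursion on the first argument k yielding the code A, B or C for k = 0, 1 or ≥ 2.
branchCode : ℕ → ℕ → ℕ → ℕ
branchCode A B C = code (s5 (const A) (code (s6 0 (code (s5 (const B) (const C))))))

switch : ℕ → ℕ → ℕ → ℕ
switch A B C = code (s4 (code s9) (branchCode A B C))

-- Applies the type-1 argument at position p to the argument at position 1.
applyArg : ℕ → ℕ
applyArg p = pull p (apply (pull 3 head))

module _ {ωs : List Ty} {Ω : Args ωs → ℕ → Set} where

  open Kleene ωs Ω

  const-comp : ∀ {q σs} {Φ : Args σs} → Comp (const q) Φ q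
  const-comp = S2 (decode-code _)

  head-comp : ∀ {σs x} {Φ : Args σs} → Comp {ι ∷ σs} head (x , Φ) (x tt)
  head-comp = S3 (decode-code _)

  pull-comp : ∀ k {e σs} {Φ : Args σs} {n} → Comp e (toFront k Φ) n → Comp (pull k e) Φ n
  pull-comp zero d = d
  pull-comp (suc k) d = S6 (decode-code _) (pull-comp k d)

  apply-comp : ∀ {e ρs σs} {F : ⟦ ar ρs ⟧} {Φ : Args σs} {ψ : Args ρs} →
               Tots e {ar ρs ∷ σs} (F , Φ) 0 ρs ψ → Comp {ar ρs ∷ σs} (apply e) (F , Φ) (F ψ)
  apply-comp = S8 (decode-code _)

  oracle-comp : ∀ {e σs} {Φ : Args σs} {ψ : Args ωs} {n} →
                Tots e Φ 0 ωs ψ → Ω ψ n → Comp (oracle e) Φ n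
  oracle-comp = SO (decode-code _)

  branchCode-0 : ∀ {A B C σs} {Φ : Args σs} → Comp {ι ∷ σs} (branchCode A B C) (num 0 , Φ) A
  branchCode-0 = S5z (decode-code _) refl const-comp

  branchCode-1 : ∀ {A B C σs} {Φ : Args σs} → Comp {ι ∷ σs} (branchCode A B C) (num 1 , Φ) B
  branchCode-1 = S5s (decode-code _) refl branchCode-0
    (S6 (decode-code _) (S5z (decode-code _) refl const-comp))

  branchCode-2 : ∀ {A B C σs} {Φ : Args σs} → Comp {ι ∷ σs} (branchCode A B C) (num 2 , Φ) C
  branchCode-2 = S5s (decode-code _) refl branchCode-1
    (S6 (decode-code _) (S5s (decode-code _) refl (S5z (decode-code _) refl const-comp) const-comp))

  switch-comp : ∀ {A B C b k σs} {Φ : Args σs} {n} →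
                Comp {ι ∷ σs} (branchCode A B C) (num k , Φ) b → Comp {ι ∷ σs} b (num k , Φ) n →
                Comp {ι ∷ σs} (switch A B C) (num k , Φ) n
  switch-comp branch d = S4 (decode-code _) branch (S9 (decode-code _) d)

dropIndex : ⟦ TY₀ ⟧ → ⟦ TY ⟧
dropIndex Y (_ , m , f , _) = Y (m , f , tt)

fixIndex : ⟦ TY ⟧ → ⟦ ι ⟧ → ⟦ TY₀ ⟧
fixIndex Y n (m , f , _) = Y (n , m , f , tt)

dropIndex-cong : ∀ {Y Y'} → Eq TY₀ Y Y' → Eq TY (dropIndex Y) (dropIndex Y')
dropIndex-cong Y≈Y' (_ , m , f , _) (_ , m' , f' , _) (_ , m≈m' , f≈f' , _) =
  Y≈Y' (m , f , tt) (m' , f' , tt) (m≈m' , f≈f' , tt)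

fixIndex-cong : ∀ {Y Y' n n'} → Eq TY Y Y' → Eq ι n n' → Eq TY₀ (fixIndex Y n) (fixIndex Y' n')
fixIndex-cong Y≈Y' n≈n' (m , f , _) (m' , f' , _) (m≈m' , f≈f' , _) =
  Y≈Y' (_ , m , f , tt) (_ , m' , f' , tt) (n≈n' , m≈m' , f≈f' , tt)

dropIndexCode : ℕ
dropIndexCode = pull 4 (apply (switch (pull 4 head) (applyArg 6) (applyArg 6)))

fixIndexCode : ℕ
fixIndexCode = pull 3 (apply (switch (pull 5 head) (pull 3 head) (applyArg 5)))

module _ {ωs : List Ty} {Ω : Args ωs → ℕ → Set} where

  open Kleene ωs Ω

  dropIndexCode-comp : ∀ (Y : ⟦ TY₀ ⟧) n m f →
                       Comp dropIndexCode (num 0 , n , m , f , Y , tt) (dropIndex Y (n , m , f , tt))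
  dropIndexCode-comp Y n m f =
    pull-comp 4 (apply-comp ((λ _ → number) ∷ (λ { (x , _) → bit x }) ∷ []))
    where
      number : Comp (switch (pull 4 head) (applyArg 6) (applyArg 6))
                   (num 0 , Y , num 0 , n , m , f , tt) (m tt)
      number = switch-comp branchCode-0 (pull-comp 4 head-comp)
      bit : ∀ x → Comp (switch (pull 4 head) (applyArg 6) (applyArg 6))
                       (num 1 , x , Y , num 0 , n , m , f , tt) (f (x , tt))
      bit x = switch-comp branchCode-1 (pull-comp 6 (apply-comp ((λ _ → pull-comp 3 head-comp) ∷ [])))

  fixIndexCode-comp : ∀ (Y : ⟦ TY ⟧) n m f →
                      Comp fixIndexCode (num 0 , m , f , Y , n , tt) (fixIndex Y n (m , f , tt))
  fixIndexCode-comp Y n m f =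
    pull-comp 3 (apply-comp ((λ _ → index) ∷ (λ _ → number) ∷ (λ { (x , _) → bit x }) ∷ []))
    where
      index : Comp (switch (pull 5 head) (pull 3 head) (applyArg 5))
                   (num 0 , Y , num 0 , m , f , n , tt) (n tt)
      index = switch-comp branchCode-0 (pull-comp 5 head-comp)
      number : Comp (switch (pull 5 head) (pull 3 head) (applyArg 5))
                    (num 1 , Y , num 0 , m , f , n , tt) (m tt)
      number = switch-comp branchCode-1 (pull-comp 3 head-comp)
      bit : ∀ x → Comp (switch (pull 5 head) (pull 3 head) (applyArg 5))
                       (num 2 , x , Y , num 0 , m , f , n , tt) (f (x , tt))
      bit x = switch-comp branchCode-2 (pull-comp 5 (apply-comp ((λ _ → pull-comp 3 head-comp) ∷ [])))

weakFromPartial : ℕ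
weakFromPartial = oracle (switch dropIndexCode (const 0) (const 0))

partialFromWeak : ℕ
partialFromWeak = oracle fixIndexCode

partial⇒weakPartial : (ζ : Args (TY ∷ ι ∷ []) → ℕ → Set) → IsPartialNCC ζ →
                      Σ (Args (TY₀ ∷ []) → ℕ → Set) λ ζ₀ → IsWeakPartialNCC ζ₀ × ComputableIn ζ ζ₀
partial⇒weakPartial ζ (ζ-functional , ζ-realises) =
  Comp weakFromPartial ,
  (comp-isPartialFunctional ζ-functional weakFromPartial , realises) ,
  comp-computableIn weakFromPartial
  where
    open Kleene (TY ∷ ι ∷ []) ζ

    realises : ∀ Y → Eq TY₀ Y Y → (Σ ℕ λ m → Σ (ℕ → Bool) λ f → app₁ Y m f ≡ 0) →
               Σ ℕ λ m → Comp weakFromPartial (Y , tt) m × (Σ (ℕ → Bool) λ f → app₁ Y m f ≡ 0)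
    realises Y Y≈Y (m , f , Ymf≡0)
      with ζ-realises (dropIndex Y) (dropIndex-cong Y≈Y) (λ _ → m , f , Ymf≡0)
    ... | g , g-ζ , g-good = g 0 , oracle-comp queries (g-ζ 0) , g-good 0
      where
        queries : Tots (switch dropIndexCode (const 0) (const 0)) (Y , tt) 0 (TY ∷ ι ∷ [])
                       (dropIndex Y , num 0 , tt)
        queries = (λ { (n , k , b , _) → switch-comp branchCode-0 (dropIndexCode-comp Y n k b) })
                ∷ (λ _ → switch-comp branchCode-1 const-comp) ∷ []

weakPartial⇒partial : (ζ₀ : Args (TY₀ ∷ []) → ℕ → Set) → IsWeakPartialNCC ζ₀ →
                      Σ (Args (TY ∷ ι ∷ []) → ℕ → Set) λ ζ → IsPartialNCC ζ × ComputableIn ζ₀ ζ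
weakPartial⇒partial ζ₀ (ζ₀-functional , ζ₀-realises) =
  Comp partialFromWeak ,
  (comp-isPartialFunctional ζ₀-functional partialFromWeak , realises) ,
  comp-computableIn partialFromWeak
  where
    open Kleene (TY₀ ∷ []) ζ₀

    realises : ∀ Y → Eq TY Y Y → (∀ n → Σ ℕ λ m → Σ (ℕ → Bool) λ f → app₂ Y n m f ≡ 0) →
               Σ (ℕ → ℕ) λ g → (∀ n → Comp partialFromWeak (Y , num n , tt) (g n)) ×
                               (∀ n → Σ (ℕ → Bool) λ f → app₂ Y n (g n) f ≡ 0)
    realises Y Y≈Y solvable = (λ n → proj₁ (answer n)) ,
                              (λ n → oracle-comp (query n) (proj₁ (proj₂ (answer n)))) ,
                              (λ n → proj₂ (proj₂ (answer n)))
      where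
        answer : ∀ n → Σ ℕ λ m → ζ₀ (fixIndex Y (num n) , tt) m ×
                                 (Σ (ℕ → Bool) λ f → app₁ (fixIndex Y (num n)) m f ≡ 0)
        answer n = ζ₀-realises (fixIndex Y (num n)) (fixIndex-cong Y≈Y (num-cong refl)) (solvable n)
        query : ∀ n → Tots fixIndexCode (Y , num n , tt) 0 (TY₀ ∷ []) (fixIndex Y (num n) , tt)
        query n = (λ { (k , b , _) → fixIndexCode-comp Y (num n) k b }) ∷ []

lemma4p13 : ((ζ : Args (TY ∷ ι ∷ []) → ℕ → Set) → IsPartialNCC ζ →
    Σ (Args (TY₀ ∷ []) → ℕ → Set) λ ζ₀ → IsWeakPartialNCC ζ₀ × ComputableIn ζ ζ₀)
    × ((ζ₀ : Args (TY₀ ∷ []) → ℕ → Set) → IsWeakPartialNCC ζ₀ →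
    Σ (Args (TY ∷ ι ∷ []) → ℕ → Set) λ ζ → IsPartialNCC ζ × ComputableIn ζ₀ ζ)
lemma4p13 = partial⇒weakPartial , weakPartial⇒partial
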